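{- Let $G=(V,E,c)$ be an undirected graph with positive integer edge weights and terminal set $T=\{t_1,\dots,t_k\}\subseteq V$, and let $\mathcal{C}$ be (the edge set of) a minimum multiterminal cut of $G$, of weight $\mathcal{W}(G)$. If vertices $u$ and $v$ belong to different connected components of $(V,E\setminus\mathcal{C})$, then $$\lambda(u,v)+\frac{\sum_{i\in\{1,\dots,k\}\setminus \max_2}\lambda(G,t_i,T\setminus\{t_i\})}{4}\le \mathcal{W}(G),$$ where $\max_2$ is the set of the indices of the two largest values $\lambda(G,t_i,T\setminus\{t_i\})$.
   Context: A multiterminal cut of $G$ for terminals $t_1,\dots,t_k$ is a partition of $V$ into blocks $V_1,\dots,V_k$ with $t_j\in V_j$; its edge set consists of the edges whose endpoints lie in different blocks and its weight is the total weight of these edges. A minimum multiterminal cut has minimum weight; $\mathcal{W}(G)$ denotes this minimum weight. $\lambda(u,v)$ is the minimum weight of a cut of $G$ separating $u$ and $v$. For a vertex $s$ and a vertex set $T'$ not containing $s$, $\lambda(G,s,T')$ is the minimum weight of a cut $(A,V\setminus A)$ with $s\in A$ and $T'\subseteq V\setminus A$ (a minimum $s$-$T'$-cut). -}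

module Defs where

open import Data.Nat using (ℕ; zero; suc; _+_; _*_; _≤_; _<_; _<?_)
open import Data.Fin using (Fin; toℕ) renaming (zero to fzero; suc to fsuc)
import Data.Fin as F
open import Data.Bool using (Bool; true; false; _∧_; _∨_; not; if_then_else_)
open import Data.Product using (Σ; _×_; _,_)
open import Relation.Nullary using (¬_)
open import Relation.Nullary.Decidable using (⌊_⌋)
open import Relation.Binary.PropositionalEquality using (_≡_; _≢_)

sumFin : ∀ {n} → (Fin n → ℕ) → ℕ
sumFin {zero}  f = 0
sumFin {suc n} f = f fzero + sumFin (λ i → f (fsuc i))

-- An undirected graph with vertex set Fin n and positive integer edge
-- weights: w u v is the weight of edge uv, 0 meaning "no edge".
record WGraph (n : ℕ) : Set where
  field
    w    : Fin n → Fin n → ℕ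
    symm : ∀ u v → w u v ≡ w v u
open WGraph public

cutWeight : ∀ {n} → WGraph n → (Fin n → Bool) → ℕ
cutWeight G A = sumFin λ u → sumFin λ v →
  if A u ∧ not (A v) then w G u v else 0

IsMinCutValue : ∀ {n} → WGraph n → Fin n → Fin n → ℕ → Set
IsMinCutValue {n} G u v L =
  Σ (Fin n → Bool) (λ A → A u ≡ true × A v ≡ false × cutWeight G A ≡ L)
  × (∀ (A : Fin n → Bool) → A u ≡ true → A v ≡ false → L ≤ cutWeight G A)

IsMinIsolatingValue : ∀ {n k} → WGraph n → (Fin k → Fin n) → Fin k → ℕ → Set
IsMinIsolatingValue {n} {k} G t i L =
  Σ (Fin n → Bool) (λ A → A (t i) ≡ true
                        × (∀ j → j ≢ i → A (t j) ≡ false)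
                        × cutWeight G A ≡ L)
  × (∀ (A : Fin n → Bool) → A (t i) ≡ true
       → (∀ j → j ≢ i → A (t j) ≡ false) → L ≤ cutWeight G A)

-- A multiterminal cut: partition of V into blocks V_1..V_k, given by the
-- block-assignment P, with t_j ∈ V_j.
IsMultiterminalCut : ∀ {n k} → (Fin k → Fin n) → (Fin n → Fin k) → Set
IsMultiterminalCut t P = ∀ j → P (t j) ≡ j

-- Weight of a partition: total weight of edges (each unordered pair once)
-- whose endpoints lie in different blocks.
mtcWeight : ∀ {n k} → WGraph n → (Fin n → Fin k) → ℕ
mtcWeight G P = sumFin λ u → sumFin λ v →
  if ⌊ toℕ u <? toℕ v ⌋ ∧ not ⌊ P u F.≟ P v ⌋ then w G u v else 0

IsMinMultiterminalCut : ∀ {n k} → WGraph n → (Fin k → Fin n) → (Fin n → Fin k) → Set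
IsMinMultiterminalCut G t P =
  IsMultiterminalCut t P
  × (∀ Q → IsMultiterminalCut t Q → mtcWeight G P ≤ mtcWeight G Q)

-- Reachability in (V, E ∖ C) where C is the edge set of the cut P:
-- an edge uv (w u v > 0) survives iff u and v lie in the same block.
data Reach {n k} (G : WGraph n) (P : Fin n → Fin k) (u : Fin n) : Fin n → Set where
  here : Reach G P u u
  step : ∀ {x y} → Reach G P u x → 0 < w G x y → P x ≡ P y → Reach G P u y

IsMax2 : ∀ {k} → (Fin k → ℕ) → Fin k → Fin k → Set
IsMax2 f a b = a ≢ b × (∀ i → i ≢ a → i ≢ b → f i ≤ f a × f i ≤ f b)

sumExcept2 : ∀ {k} → (Fin k → ℕ) → Fin k → Fin k → ℕ
sumExcept2 f a b = sumFin λ i →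
  if ⌊ i F.≟ a ⌋ ∨ ⌊ i F.≟ b ⌋ then 0 else f i

module Submission where

-- Let d l be the weight of the cut around block l of the minimum multiterminal cut P.
-- Every cut edge is counted by the two blocks it joins, so Σ d = 2𝒲, and d l bounds the
-- isolating value of t l. If u and v lie in different blocks, λ(u,v) ≤ d(P u), d(P v) and
-- the isolating values outside the two largest are dominated by the d l with l ∉ {P u, P v},
-- whence 4λ + Σ ≤ 2 (d(P u) + d(P v)) + Σ_{l ≠ P u, P v} d l ≤ 2 Σ d = 4𝒲. If they lie in
-- one block, the component of u or of v misses the block's terminal, so no edge leaves it
-- (otherwise re-assigning it would lighten P); hence λ(u,v) = 0 and Σ ≤ Σ d = 2𝒲.

open import Defs
open import Data.Nat using (ℕ; zero; suc; _+_; _*_; _≤_; _<_; _<?_; _≤?_; z≤n)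
open import Data.Nat.Properties
  using ( +-identityʳ; +-comm; +-assoc; +-commutativeSemigroup; +-mono-≤; +-monoˡ-≤; +-monoʳ-≤
        ; +-mono-<-≤; +-mono-≤-<; +-cancelˡ-≤; *-monoʳ-≤; m≤m+n; n≤0⇒n≡0
        ; ≤-refl; ≤-reflexive; ≤-trans; ≤-antisym; ≮⇒≥; <⇒≱; <-asym; <-cmp; module ≤-Reasoning )
open import Data.Nat.Tactic.RingSolver using (solve)
open import Data.List using (_∷_; [])
open import Data.Fin using (Fin; toℕ; _≟_) renaming (zero to fzero; suc to fsuc)
open import Data.Fin.Properties using (suc-injective; toℕ-injective)
open import Data.Bool using (Bool; true; false; _∧_; _∨_; not; if_then_else_)
open import Data.Product using (_,_; proj₁; proj₂)
open import Function using (_∘_)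
open import Function.Definitions using (Injective)
open import Effect.Monad using (RawMonad)
open import Relation.Binary.Definitions using (tri<; tri≈; tri>)
open import Relation.Nullary using (¬_; Dec; yes; no; contradiction)
open import Relation.Nullary.Decidable using (⌊_⌋; decidable-stable; ¬¬-excluded-middle)
open import Relation.Nullary.Negation using (¬¬-Monad)
open import Relation.Binary.PropositionalEquality
open import Algebra.Properties.CommutativeSemigroup +-commutativeSemigroup using (interchange)

sumFin-cong : ∀ {n} {f g : Fin n → ℕ} → (∀ i → f i ≡ g i) → sumFin f ≡ sumFin g
sumFin-cong {zero}  f≗g = refl
sumFin-cong {suc n} f≗g = cong₂ _+_ (f≗g fzero) (sumFin-cong (f≗g ∘ fsuc))

sumFin-mono : ∀ {n} {f g : Fin n → ℕ} → (∀ i → f i ≤ g i) → sumFin f ≤ sumFin g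
sumFin-mono {zero}  f≤g = z≤n
sumFin-mono {suc n} f≤g = +-mono-≤ (f≤g fzero) (sumFin-mono (f≤g ∘ fsuc))

sumFin-mono-< : ∀ {n} {f g : Fin n → ℕ} → (∀ i → f i ≤ g i) →
                ∀ i → f i < g i → sumFin f < sumFin g
sumFin-mono-< f≤g fzero    fi<gi = +-mono-<-≤ fi<gi (sumFin-mono (f≤g ∘ fsuc))
sumFin-mono-< f≤g (fsuc i) fi<gi = +-mono-≤-< (f≤g fzero) (sumFin-mono-< (f≤g ∘ fsuc) i fi<gi)

sumFin-zero : ∀ {n} {f : Fin n → ℕ} → (∀ i → f i ≡ 0) → sumFin f ≡ 0
sumFin-zero {zero}  f≗0 = refl
sumFin-zero {suc n} f≗0 = cong₂ _+_ (f≗0 fzero) (sumFin-zero (f≗0 ∘ fsuc))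

sumFin-+ : ∀ {n} (f g : Fin n → ℕ) → sumFin (λ i → f i + g i) ≡ sumFin f + sumFin g
sumFin-+ {zero}  f g = refl
sumFin-+ {suc n} f g = trans (cong (f fzero + g fzero +_) (sumFin-+ (f ∘ fsuc) (g ∘ fsuc)))
                             (interchange (f fzero) (g fzero) _ _)

sumFin-swap : ∀ {m n} (f : Fin m → Fin n → ℕ) →
              sumFin (λ i → sumFin (f i)) ≡ sumFin (λ j → sumFin (λ i → f i j))
sumFin-swap {zero} {n} f = sym (sumFin-zero {n} (λ _ → refl))
sumFin-swap {suc m} f = trans (cong (sumFin (f fzero) +_) (sumFin-swap (f ∘ fsuc)))
                              (sym (sumFin-+ (f fzero) _))

sumFin-single : ∀ {n} (f : Fin n → ℕ) i → (∀ j → j ≢ i → f j ≡ 0) → sumFin f ≡ f i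
sumFin-single f fzero    f≗0 =
  trans (cong (f fzero +_) (sumFin-zero (λ j → f≗0 (fsuc j) (λ ())))) (+-identityʳ _)
sumFin-single f (fsuc i) f≗0 =
  cong₂ _+_ (f≗0 fzero (λ ())) (sumFin-single (f ∘ fsuc) i (λ j j≢i → f≗0 (fsuc j) (j≢i ∘ suc-injective)))

sumFin²-mono-< : ∀ {m n} {f g : Fin m → Fin n → ℕ} → (∀ i j → f i j ≤ g i j) →
                 ∀ i j → f i j < g i j → sumFin (λ i → sumFin (f i)) < sumFin (λ i → sumFin (g i))
sumFin²-mono-< f≤g i j fij<gij =
  sumFin-mono-< (λ i′ → sumFin-mono (f≤g i′)) i (sumFin-mono-< (f≤g i) j fij<gij)

⌊⌋≡true : ∀ {A : Set} (a? : Dec A) → A → ⌊ a? ⌋ ≡ true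
⌊⌋≡true (yes _) _ = refl
⌊⌋≡true (no ¬a) a = contradiction a ¬a

⌊⌋≡false : ∀ {A : Set} (a? : Dec A) → ¬ A → ⌊ a? ⌋ ≡ false
⌊⌋≡false (yes a) ¬a = contradiction a ¬a
⌊⌋≡false (no _)  _  = refl

⌊≟⌋-sym : ∀ {n} (x y : Fin n) → ⌊ x ≟ y ⌋ ≡ ⌊ y ≟ x ⌋
⌊≟⌋-sym x y with x ≟ y
... | yes x≡y = sym (⌊⌋≡true (y ≟ x) (sym x≡y))
... | no  x≢y = sym (⌊⌋≡false (y ≟ x) (x≢y ∘ sym))

sumFin-at : ∀ {n} (f : Fin n → ℕ) i → sumFin (λ j → if ⌊ j ≟ i ⌋ then f j else 0) ≡ f i
sumFin-at f i = trans (sumFin-single _ i off) on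
  where
  off : ∀ j → j ≢ i → (if ⌊ j ≟ i ⌋ then f j else 0) ≡ 0
  off j j≢i rewrite ⌊⌋≡false (j ≟ i) j≢i = refl
  on : (if ⌊ i ≟ i ⌋ then f i else 0) ≡ f i
  on rewrite ⌊⌋≡true (i ≟ i) refl = refl

sumFin-split2 : ∀ {k} (f : Fin k → ℕ) a b → a ≢ b → sumFin f ≡ f a + (f b + sumExcept2 f a b)
sumFin-split2 f a b a≢b = begin
    sumFin f
  ≡⟨ sumFin-cong split ⟩
    sumFin (λ i → at a i + (at b i + rest i))
  ≡⟨ trans (sumFin-+ (at a) _) (cong (sumFin (at a) +_) (sumFin-+ (at b) rest)) ⟩
    sumFin (at a) + (sumFin (at b) + sumExcept2 f a b)
  ≡⟨ cong₂ (λ x y → x + (y + sumExcept2 f a b)) (sumFin-at f a) (sumFin-at f b) ⟩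
    f a + (f b + sumExcept2 f a b) ∎
  where
  open ≡-Reasoning
  at : Fin _ → Fin _ → ℕ
  at c i = if ⌊ i ≟ c ⌋ then f i else 0
  rest : Fin _ → ℕ
  rest i = if ⌊ i ≟ a ⌋ ∨ ⌊ i ≟ b ⌋ then 0 else f i
  split : ∀ i → f i ≡ at a i + (at b i + rest i)
  split i with i ≟ a | i ≟ b
  ... | yes refl | yes a≡b = contradiction a≡b a≢b
  ... | yes _    | no _    = sym (+-identityʳ _)
  ... | no _     | yes _   = sym (+-identityʳ _)
  ... | no _     | no _    = refl

sumExcept2≤sumFin : ∀ {k} (f : Fin k → ℕ) a b → sumExcept2 f a b ≤ sumFin f
sumExcept2≤sumFin f a b = sumFin-mono (λ i → drop (⌊ i ≟ a ⌋ ∨ ⌊ i ≟ b ⌋) (f i))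
  where
  drop : ∀ c x → (if c then 0 else x) ≤ x
  drop true  x = z≤n
  drop false x = ≤-refl

sumExcept2-mono : ∀ {k} {f g : Fin k → ℕ} a b → (∀ i → f i ≤ g i) → sumExcept2 f a b ≤ sumExcept2 g a b
sumExcept2-mono a b f≤g = sumFin-mono (λ i → keep (⌊ i ≟ a ⌋ ∨ ⌊ i ≟ b ⌋) (f≤g i))
  where
  keep : ∀ c {x y} → x ≤ y → (if c then 0 else x) ≤ (if c then 0 else y)
  keep true  _   = z≤n
  keep false x≤y = x≤y

IsMax2⇒≤first : ∀ {k} {f : Fin k → ℕ} {a b} → IsMax2 f a b → ∀ {l} → l ≢ b → f l ≤ f a
IsMax2⇒≤first {a = a} (_ , max) {l} l≢b with l ≟ a
... | yes refl = ≤-refl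
... | no  l≢a  = proj₁ (max l l≢a l≢b)

IsMax2⇒≤second : ∀ {k} {f : Fin k → ℕ} {a b} → IsMax2 f a b → ∀ {l} → l ≢ a → f l ≤ f b
IsMax2⇒≤second {b = b} (_ , max) {l} l≢a with l ≟ b
... | yes refl = ≤-refl
... | no  l≢b  = proj₂ (max l l≢a l≢b)

IsMax2⇒+-≤ : ∀ {k} {f : Fin k → ℕ} {a b} → IsMax2 f a b → ∀ {i j} → i ≢ j → f i + f j ≤ f a + f b
IsMax2⇒+-≤ {f = f} {a} {b} max2 {i} {j} i≢j with i ≟ b | j ≟ a
... | no i≢b   | no j≢a   = +-mono-≤ (IsMax2⇒≤first max2 i≢b) (IsMax2⇒≤second max2 j≢a)
... | yes refl | _        = ≤-trans (+-monoʳ-≤ (f b) (IsMax2⇒≤first max2 (i≢j ∘ sym)))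
                                    (≤-reflexive (+-comm (f b) (f a)))
... | no _     | yes refl = ≤-trans (+-monoˡ-≤ (f a) (IsMax2⇒≤second max2 i≢j))
                                    (≤-reflexive (+-comm (f b) (f a)))

IsMax2⇒sumExcept2-≤ : ∀ {k} {f : Fin k → ℕ} {a b} → IsMax2 f a b →
                      ∀ {i j} → i ≢ j → sumExcept2 f a b ≤ sumExcept2 f i j
IsMax2⇒sumExcept2-≤ {f = f} {a} {b} max2 {i} {j} i≢j = +-cancelˡ-≤ (f a + f b) _ _ (begin
    f a + f b + sumExcept2 f a b
  ≡⟨ trans (+-assoc (f a) (f b) _) (sym (sumFin-split2 f a b (proj₁ max2))) ⟩
    sumFin f
  ≡⟨ trans (sumFin-split2 f i j i≢j) (sym (+-assoc (f i) (f j) _)) ⟩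
    f i + f j + sumExcept2 f i j
  ≤⟨ +-monoˡ-≤ (sumExcept2 f i j) (IsMax2⇒+-≤ max2 i≢j) ⟩
    f a + f b + sumExcept2 f i j ∎)
  where open ≤-Reasoning

module _ {n} (G : WGraph n) where

  cutWeight-not : ∀ (A : Fin n → Bool) → cutWeight G (not ∘ A) ≡ cutWeight G A
  cutWeight-not A = trans (sumFin-swap {n} {n} _) (sumFin-cong λ v → sumFin-cong λ u → term (A u) (A v))
    where
    term : ∀ {u v} a b → (if not a ∧ not (not b) then w G u v else 0) ≡ (if b ∧ not a then w G v u else 0)
    term {u} {v} false true  = symm G u v
    term         false false = refl
    term         true  true  = refl
    term         true  false = refl

  cutWeight-closed : ∀ {Q : Fin n → Set} (Q? : ∀ x → Dec (Q x)) →
                     (∀ {x y} → Q x → ¬ Q y → w G x y ≡ 0) → cutWeight G (λ x → ⌊ Q? x ⌋) ≡ 0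
  cutWeight-closed Q? closed = sumFin-zero λ x → sumFin-zero λ y → term x y
    where
    term : ∀ x y → (if ⌊ Q? x ⌋ ∧ not ⌊ Q? y ⌋ then w G x y else 0) ≡ 0
    term x y with Q? x | Q? y
    ... | yes Qx | no ¬Qy = closed Qx ¬Qy
    ... | yes _  | yes _  = refl
    ... | no _   | _      = refl

  IsMinCutValue-sym : ∀ {u v L} → IsMinCutValue G u v L → IsMinCutValue G v u L
  IsMinCutValue-sym ((A , Au , Av , cut≡L) , min) =
    (not ∘ A , cong not Av , cong not Au , trans (cutWeight-not A) cut≡L) ,
    λ B Bv Bu → ≤-trans (min (not ∘ B) (cong not Bu) (cong not Bv)) (≤-reflexive (cutWeight-not B))

  mtcTerm : ∀ {k} → (Fin n → Fin k) → Fin n → Fin n → ℕ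
  mtcTerm P u v = if ⌊ toℕ u <? toℕ v ⌋ ∧ not ⌊ P u ≟ P v ⌋ then w G u v else 0

  module _ {k} (P : Fin n → Fin k) where

    inBlock : Fin k → Fin n → Bool
    inBlock l x = ⌊ P x ≟ l ⌋

    blockCut : Fin k → ℕ
    blockCut l = cutWeight G (inBlock l)

    crossing : Fin n → Fin n → ℕ
    crossing u v = if not ⌊ P u ≟ P v ⌋ then w G u v else 0

    crossing≡mtcTerm+mtcTerm : ∀ u v → crossing u v ≡ mtcTerm P u v + mtcTerm P v u
    crossing≡mtcTerm+mtcTerm u v with toℕ u <? toℕ v | toℕ v <? toℕ u
    ... | yes u<v | yes v<u = contradiction v<u (<-asym u<v)
    ... | yes _   | no _    = sym (+-identityʳ _)
    ... | no _    | yes _   rewrite ⌊≟⌋-sym (P u) (P v) | symm G u v = refl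
    ... | no u≮v  | no v≮u  rewrite toℕ-injective (≤-antisym (≮⇒≥ v≮u) (≮⇒≥ u≮v))
                                  | ⌊⌋≡true (P v ≟ P v) refl = refl

    sumFin-crossing : sumFin (λ u → sumFin (crossing u)) ≡ mtcWeight G P + mtcWeight G P
    sumFin-crossing = begin
        sumFin (λ u → sumFin (crossing u))
      ≡⟨ sumFin-cong (λ u → trans (sumFin-cong (crossing≡mtcTerm+mtcTerm u)) (sumFin-+ (mtcTerm P u) _)) ⟩
        sumFin (λ u → sumFin (mtcTerm P u) + sumFin (λ v → mtcTerm P v u))
      ≡⟨ sumFin-+ (λ u → sumFin (mtcTerm P u)) _ ⟩
        mtcWeight G P + sumFin (λ u → sumFin (λ v → mtcTerm P v u))
      ≡⟨ cong (mtcWeight G P +_) (sym (sumFin-swap (mtcTerm P))) ⟩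
        mtcWeight G P + mtcWeight G P ∎
      where open ≡-Reasoning

    sumFin-blockCut-edge : ∀ u v →
      sumFin (λ l → if inBlock l u ∧ not (inBlock l v) then w G u v else 0) ≡ crossing u v
    sumFin-blockCut-edge u v = trans (sumFin-single _ (P u) off) on
      where
      off : ∀ l → l ≢ P u → (if inBlock l u ∧ not (inBlock l v) then w G u v else 0) ≡ 0
      off l l≢Pu rewrite ⌊⌋≡false (P u ≟ l) (l≢Pu ∘ sym) = refl
      on : (if inBlock (P u) u ∧ not (inBlock (P u) v) then w G u v else 0) ≡ crossing u v
      on rewrite ⌊⌋≡true (P u ≟ P u) refl | ⌊≟⌋-sym (P v) (P u) = refl

    sumFin-blockCut : sumFin blockCut ≡ mtcWeight G P + mtcWeight G P
    sumFin-blockCut = begin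
        sumFin (λ l → sumFin (λ u → sumFin (λ v → edge l u v)))
      ≡⟨ sumFin-swap (λ l u → sumFin (edge l u)) ⟩
        sumFin (λ u → sumFin (λ l → sumFin (λ v → edge l u v)))
      ≡⟨ sumFin-cong (λ u → sumFin-swap (λ l v → edge l u v)) ⟩
        sumFin (λ u → sumFin (λ v → sumFin (λ l → edge l u v)))
      ≡⟨ sumFin-cong (λ u → sumFin-cong (sumFin-blockCut-edge u)) ⟩
        sumFin (λ u → sumFin (crossing u))
      ≡⟨ sumFin-crossing ⟩
        mtcWeight G P + mtcWeight G P ∎
      where
      open ≡-Reasoning
      edge : Fin k → Fin n → Fin n → ℕ
      edge l u v = if inBlock l u ∧ not (inBlock l v) then w G u v else 0

  module _ {k} (P Q : Fin n → Fin k) where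

    mtcTerm-mono : (∀ a b → 0 < w G a b → P a ≡ P b → Q a ≡ Q b) →
                   ∀ a b → mtcTerm Q a b ≤ mtcTerm P a b
    mtcTerm-mono coarser a b with toℕ a <? toℕ b | Q a ≟ Q b | P a ≟ P b
    ... | no _  | _        | _     = z≤n
    ... | yes _ | yes _    | _     = z≤n
    ... | yes _ | no _     | no _  = ≤-refl
    ... | yes _ | no Qa≢Qb | yes Pa≡Pb = ≮⇒≥ (λ wab → Qa≢Qb (coarser a b wab Pa≡Pb))

    mtcTerm-< : ∀ {x y} → toℕ x < toℕ y → 0 < w G x y → Q x ≡ Q y → P x ≢ P y →
                mtcTerm Q x y < mtcTerm P x y
    mtcTerm-< {x} {y} x<y wxy Qx≡Qy Px≢Py
      rewrite ⌊⌋≡true (toℕ x <? toℕ y) x<y | ⌊⌋≡true (Q x ≟ Q y) Qx≡Qy | ⌊⌋≡false (P x ≟ P y) Px≢Py = wxy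

    mtcWeight-< : (∀ a b → 0 < w G a b → P a ≡ P b → Q a ≡ Q b) →
                  ∀ {x y} → 0 < w G x y → Q x ≡ Q y → P x ≢ P y → mtcWeight G Q < mtcWeight G P
    mtcWeight-< coarser {x} {y} wxy Qx≡Qy Px≢Py with <-cmp (toℕ x) (toℕ y)
    ... | tri< x<y _ _ = sumFin²-mono-< (mtcTerm-mono coarser) x y (mtcTerm-< x<y wxy Qx≡Qy Px≢Py)
    ... | tri≈ _ x≡y _ = contradiction (cong P (toℕ-injective x≡y)) Px≢Py
    ... | tri> _ _ y<x = sumFin²-mono-< (mtcTerm-mono coarser) y x
                           (mtcTerm-< y<x (subst (0 <_) (symm G x y) wxy) (sym Qx≡Qy) (Px≢Py ∘ sym))

module _ {n k} {G : WGraph n} {P : Fin n → Fin k} where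

  Reach-block : ∀ {s x} → Reach G P s x → P x ≡ P s
  Reach-block here                = refl
  Reach-block (step s→x _ Px≡Py) = trans (sym Px≡Py) (Reach-block s→x)

  Reach-trans : ∀ {s x y} → Reach G P s x → Reach G P x y → Reach G P s y
  Reach-trans s→x here                  = s→x
  Reach-trans s→x (step x→y wyz Py≡Pz) = step (Reach-trans s→x x→y) wyz Py≡Pz

  Reach-sym : ∀ {s x} → Reach G P s x → Reach G P x s
  Reach-sym here = here
  Reach-sym (step {x} {y} s→x wxy Px≡Py) =
    Reach-trans (step here (subst (0 <_) (symm G x y) wxy) (sym Px≡Py)) (Reach-sym s→x)

¬¬-decidable : ∀ {n} (Q : Fin n → Set) → ¬ ¬ (∀ x → Dec (Q x))
¬¬-decidable {zero}  Q ¬dec = ¬dec (λ ())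
¬¬-decidable {suc n} Q = do
    Q0? ← ¬¬-excluded-middle
    Qs? ← ¬¬-decidable (Q ∘ fsuc)
    pure λ { fzero → Q0? ; (fsuc x) → Qs? x }
  where open RawMonad ¬¬-Monad

module _ {n k} {G : WGraph n} {t : Fin k → Fin n} {P : Fin n → Fin k}
         (P-min : IsMinMultiterminalCut G t P) where

  -- Moving the component of s across a positive edge leaving it would give a valid
  -- (the component contains no terminal) and strictly lighter multiterminal cut.
  component-closed : ∀ {s} (reach? : ∀ x → Dec (Reach G P s x)) → ¬ Reach G P s (t (P s)) →
                     ∀ {x y} → Reach G P s x → ¬ Reach G P s y → w G x y ≡ 0
  component-closed {s} reach? s↛t {x} {y} s→x s↛y = n≤0⇒n≡0 (≮⇒≥ no-positive-edge)
    where
    no-positive-edge : ¬ 0 < w G x y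
    no-positive-edge wxy with P y ≟ P s
    ... | yes Py≡Ps = s↛y (step s→x wxy (trans (Reach-block s→x) (sym Py≡Ps)))
    ... | no  Py≢Ps = <⇒≱ (mtcWeight-< G P Q coarser wxy Qx≡Qy Px≢Py) (proj₂ P-min Q Q-valid)
      where
      Q : Fin n → Fin k
      Q z = if ⌊ reach? z ⌋ then P y else P z

      Q-valid : IsMultiterminalCut t Q
      Q-valid l with reach? (t l)
      ... | no  _    = proj₁ P-min l
      ... | yes s→tl = contradiction (subst (λ m → Reach G P s (t m)) l≡Ps s→tl) s↛t
        where
        l≡Ps : l ≡ P s
        l≡Ps = trans (sym (proj₁ P-min l)) (Reach-block s→tl)

      coarser : ∀ a b → 0 < w G a b → P a ≡ P b → Q a ≡ Q b
      coarser a b wab Pa≡Pb with reach? a | reach? b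
      ... | yes _   | yes _   = refl
      ... | no  _   | no  _   = Pa≡Pb
      ... | yes s→a | no  s↛b = contradiction (step s→a wab Pa≡Pb) s↛b
      ... | no  s↛a | yes s→b = contradiction (step s→b (subst (0 <_) (symm G a b) wab) (sym Pa≡Pb)) s↛a

      Qx≡Qy : Q x ≡ Q y
      Qx≡Qy rewrite ⌊⌋≡true (reach? x) s→x | ⌊⌋≡false (reach? y) s↛y = refl

      Px≢Py : P x ≢ P y
      Px≢Py Px≡Py = Py≢Ps (trans (sym Px≡Py) (Reach-block s→x))

  component-minCut≤0 : ∀ {s r L} → IsMinCutValue G s r L → (reach? : ∀ x → Dec (Reach G P s x)) →
                       ¬ Reach G P s (t (P s)) → ¬ Reach G P s r → L ≤ 0
  component-minCut≤0 {s} {r} (_ , min) reach? s↛t s↛r =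
    ≤-trans (min (λ x → ⌊ reach? x ⌋) (⌊⌋≡true (reach? s) here) (⌊⌋≡false (reach? r) s↛r))
            (≤-reflexive (cutWeight-closed G reach? (component-closed reach? s↛t)))

  -- Of two distinct components inside one block, at least one misses the block's terminal.
  -- Reachability is decidable only under ¬¬ here, which suffices as L ≤ 0 is decidable.
  sameBlock-minCut≤0 : ∀ {u v L} → P u ≡ P v → ¬ Reach G P u v → IsMinCutValue G u v L → L ≤ 0
  sameBlock-minCut≤0 {u} {v} {L} Pu≡Pv u↛v λ-uv = decidable-stable (L ≤? 0) do
      reachᵤ? ← ¬¬-decidable (Reach G P u)
      reachᵥ? ← ¬¬-decidable (Reach G P v)
      pure (bound reachᵤ? reachᵥ?)
    where
    open RawMonad ¬¬-Monad
    bound : (∀ x → Dec (Reach G P u x)) → (∀ x → Dec (Reach G P v x)) → L ≤ 0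
    bound reachᵤ? reachᵥ? with reachᵤ? (t (P u))
    ... | no  u↛t = component-minCut≤0 λ-uv reachᵤ? u↛t u↛v
    ... | yes u→t = component-minCut≤0 (IsMinCutValue-sym G λ-uv) reachᵥ? v↛t (u↛v ∘ Reach-sym)
      where
      v↛t : ¬ Reach G P v (t (P v))
      v↛t v→t = u↛v (Reach-trans u→t (subst (λ m → Reach G P (t m) v) (sym Pu≡Pv) (Reach-sym v→t)))

module _ {n k} (G : WGraph n) (P : Fin n → Fin k) where

  isolating≤blockCut : ∀ {t : Fin k → Fin n} {l m} → IsMultiterminalCut t P →
                       IsMinIsolatingValue G t l m → m ≤ blockCut G P l
  isolating≤blockCut {t} {l} valid (_ , min) =
    min (inBlock G P l) (⌊⌋≡true (P (t l) ≟ l) (valid l))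
        (λ j j≢l → ⌊⌋≡false (P (t j) ≟ l) (j≢l ∘ trans (sym (valid j))))

  minCut≤blockCut : ∀ {u v L} → IsMinCutValue G u v L → P u ≢ P v → L ≤ blockCut G P (P u)
  minCut≤blockCut {u} {v} (_ , min) Pu≢Pv =
    min (inBlock G P (P u)) (⌊⌋≡true (P u ≟ P u) refl) (⌊⌋≡false (P v ≟ P u) (Pu≢Pv ∘ sym))

4*L+S≤4*W-split : ∀ {L S x y E W} → L ≤ x → L ≤ y → S ≤ E → x + (y + E) ≡ W + W → 4 * L + S ≤ 4 * W
4*L+S≤4*W-split {L} {S} {x} {y} {E} {W} L≤x L≤y S≤E total = begin
    4 * L + S
  ≡⟨ solve (L ∷ S ∷ []) ⟩
    2 * L + 2 * L + S
  ≤⟨ +-mono-≤ (+-mono-≤ (*-monoʳ-≤ 2 L≤x) (*-monoʳ-≤ 2 L≤y)) S≤E ⟩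
    2 * x + 2 * y + E
  ≤⟨ m≤m+n (2 * x + 2 * y + E) E ⟩
    2 * x + 2 * y + E + E
  ≡⟨ solve (x ∷ y ∷ E ∷ []) ⟩
    2 * (x + (y + E))
  ≡⟨ cong (2 *_) total ⟩
    2 * (W + W)
  ≡⟨ solve (W ∷ []) ⟩
    4 * W ∎
  where open ≤-Reasoning

4*L+S≤4*W-zero : ∀ {L S W} → L ≤ 0 → S ≤ W + W → 4 * L + S ≤ 4 * W
4*L+S≤4*W-zero {W = W} L≤0 S≤2W rewrite n≤0⇒n≡0 L≤0 =
  ≤-trans S≤2W (≤-trans (m≤m+n (W + W) (W + W)) (≤-reflexive (solve (W ∷ []))))

mainTheorem7 : ∀ {n k} (G : WGraph n) (t : Fin k → Fin n) → Injective _≡_ _≡_ t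
    → (P : Fin n → Fin k) → IsMinMultiterminalCut G t P
    → (u v : Fin n) → ¬ Reach G P u v
    → (L : ℕ) → IsMinCutValue G u v L
    → (f : Fin k → ℕ) → (∀ i → IsMinIsolatingValue G t i (f i))
    → (a b : Fin k) → IsMax2 f a b
    → 4 * L + sumExcept2 f a b ≤ 4 * mtcWeight G P
mainTheorem7 G t _ P P-min u v u↛v L λ-uv f f-iso a b max2 = bound (P u ≟ P v)
  where
  f≤blockCut : ∀ l → f l ≤ blockCut G P l
  f≤blockCut l = isolating≤blockCut G P (proj₁ P-min) (f-iso l)

  bound : Dec (P u ≡ P v) → 4 * L + sumExcept2 f a b ≤ 4 * mtcWeight G P
  bound (yes Pu≡Pv) = 4*L+S≤4*W-zero {W = mtcWeight G P} (sameBlock-minCut≤0 P-min Pu≡Pv u↛v λ-uv) (begin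
      sumExcept2 f a b         ≤⟨ sumExcept2≤sumFin f a b ⟩
      sumFin f                 ≤⟨ sumFin-mono f≤blockCut ⟩
      sumFin (blockCut G P)    ≡⟨ sumFin-blockCut G P ⟩
      mtcWeight G P + mtcWeight G P ∎)
    where open ≤-Reasoning
  bound (no Pu≢Pv) = 4*L+S≤4*W-split {W = mtcWeight G P}
    (minCut≤blockCut G P λ-uv Pu≢Pv)
    (minCut≤blockCut G P (IsMinCutValue-sym G λ-uv) (Pu≢Pv ∘ sym))
    (≤-trans (IsMax2⇒sumExcept2-≤ max2 Pu≢Pv) (sumExcept2-mono (P u) (P v) f≤blockCut))
    (trans (sym (sumFin-split2 (blockCut G P) (P u) (P v) Pu≢Pv)) (sumFin-blockCut G P))
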